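{- (Weak transitivity) For all $\alpha,\beta,\gamma\in For$: if $\{\alpha\}\vDash^{\mathbb{P}}_{G_3}\beta$ and $\{\beta\}\vDash^{\mathbb{P}}_{G_3}\gamma$, then $\{\alpha\}\vDash^{\mathbb{P}}_{G_3}\gamma$.
   Context: $For$ is the set of formulas built from a countable set $Prop$ of propositional letters with $\neg,\vee,\wedge,\rightarrow$. $G_3$ (Gödel) is given by the matrix with truth values $\{0,1/2,1\}$, designated set $\{1\}$, $f_\neg(0)=1$ and $f_\neg(x)=0$ for $x\neq 0$, $f_\vee=\max$, $f_\wedge=\min$, $f_\rightarrow(x,y)=1$ if $x\le y$ and $=y$ if $x>y$; valuations are maps $Prop\to\{0,1/2,1\}$ extended via these functions. $\Gamma\vDash_{G_3}\alpha$ iff every valuation giving all members of $\Gamma$ value $1$ gives $\alpha$ value $1$; $\Gamma$ is $G_3$-consistent iff $\{\alpha:\Gamma\vDash_{G_3}\alpha\}\neq For$. $\Gamma\vDash^{\mathbb{P}}_{G_3}\alpha$ iff there exists a $G_3$-consistent $\Gamma'\subseteq\Gamma$ with $\Gamma'\vDash_{G_3}\alpha$. -}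

module Defs where

open import Data.Nat using (ℕ)
open import Data.Product using (Σ; ∃; _×_)
open import Relation.Binary.PropositionalEquality using (_≡_)
open import Relation.Nullary using (¬_)
open import Relation.Unary using (Pred; _⊆_; _∈_; ｛_｝)
open import Level using (0ℓ)

Prop : Set
Prop = ℕ

data For : Set where
  var  : Prop → For
  ¬'_  : For → For
  _∨'_ : For → For → For
  _∧'_ : For → For → For
  _⇒'_ : For → For → For

-- Truth values {0, 1/2, 1}.
data V3 : Set where
  v0 vh v1 : V3

fneg : V3 → V3
fneg v0 = v1
fneg _  = v0

max3 : V3 → V3 → V3
max3 v0 y  = y
max3 vh v1 = v1
max3 vh _  = vh
max3 v1 _  = v1

min3 : V3 → V3 → V3
min3 v0 _  = v0
min3 vh v0 = v0
min3 vh _  = vh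
min3 v1 y  = y

-- f→(x,y) = 1 if x ≤ y, and y if x > y
fimp : V3 → V3 → V3
fimp v0 _  = v1
fimp vh v0 = v0
fimp vh _  = v1
fimp v1 y  = y

Valuation : Set
Valuation = Prop → V3

eval : Valuation → For → V3
eval v (var p)   = v p
eval v (¬' a)    = fneg (eval v a)
eval v (a ∨' b)  = max3 (eval v a) (eval v b)
eval v (a ∧' b)  = min3 (eval v a) (eval v b)
eval v (a ⇒' b)  = fimp (eval v a) (eval v b)

Theory : Set₁
Theory = Pred For 0ℓ

_⊨G3_ : Theory → For → Set
Γ ⊨G3 α = (v : Valuation) → (∀ γ → γ ∈ Γ → eval v γ ≡ v1) → eval v α ≡ v1

Consistent : Theory → Set
Consistent Γ = ∃ λ β → ¬ (Γ ⊨G3 β)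

_⊨P_ : Theory → For → Set₁
Γ ⊨P α = Σ Theory λ Γ' → (Γ' ⊆ Γ) × Consistent Γ' × (Γ' ⊨G3 α)

module Submission where

open import Defs
open import Data.Product using (_,_)
open import Relation.Binary.PropositionalEquality using (subst)
open import Relation.Unary using (_⊆_; _∈_; ｛_｝)

-- The consistent part witnessing Γ ⊨P β already entails γ, because a
-- sub-premise set of ｛ β ｝ asks for nothing beyond β itself.

⊨G3-cut : ∀ {Γ Δ : Theory} {γ} → (∀ δ → δ ∈ Δ → Γ ⊨G3 δ) → Δ ⊨G3 γ → Γ ⊨G3 γ
⊨G3-cut Γ⊨Δ Δ⊨γ v v⊨Γ = Δ⊨γ v (λ δ δ∈Δ → Γ⊨Δ δ δ∈Δ v v⊨Γ)

⊨G3-⊆-｛｝ : ∀ {Γ Δ : Theory} {β} → Γ ⊨G3 β → Δ ⊆ ｛ β ｝ → ∀ δ → δ ∈ Δ → Γ ⊨G3 δ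
⊨G3-⊆-｛｝ {Γ} Γ⊨β Δ⊆β δ δ∈Δ = subst (Γ ⊨G3_) (Δ⊆β δ∈Δ) Γ⊨β

⊨P-trans-｛｝ : ∀ {Γ : Theory} {β γ} → Γ ⊨P β → ｛ β ｝ ⊨P γ → Γ ⊨P γ
⊨P-trans-｛｝ {γ = γ} (Γ' , Γ'⊆Γ , Γ'-cons , Γ'⊨β) (Δ , Δ⊆β , _ , Δ⊨γ) =
  Γ' , Γ'⊆Γ , Γ'-cons , ⊨G3-cut {γ = γ} (⊨G3-⊆-｛｝ Γ'⊨β Δ⊆β) Δ⊨γ

proposition19 : (α β γ : For) → ｛ α ｝ ⊨P β → ｛ β ｝ ⊨P γ → ｛ α ｝ ⊨P γ
proposition19 α β γ = ⊨P-trans-｛｝ {β = β} {γ}
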